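{- Let $m,n$ be positive integers with $\gcd(m,n)>1$, and suppose that at least one of $m$ and $n$ is different from $2$. Then the tensor product $K_m \otimes K_n$ is not a circulant graph.
   Context: $K_m$ denotes the complete graph (no loops) on $m$ vertices. The tensor product $G\otimes H$ of graphs $G,H$ has vertex set $V(G)\times V(H)$, with $(g,h)$ adjacent to $(g',h')$ iff $g$ is adjacent to $g'$ in $G$ and $h$ is adjacent to $h'$ in $H$. A graph on $N$ vertices is circulant if its vertices can be labeled by $\mathbb{Z}_N=\{0,\dots,N-1\}$ so that, for some set $S\subseteq\mathbb{Z}_N$ with $S=-S$, vertices $i$ and $j$ are adjacent iff $j-i\in S \pmod N$ (equivalently, its automorphism group contains a cyclic subgroup acting transitively on the vertices). -}

module Defs where

open import Data.Nat using (ℕ; _+_; _*_; _∸_; NonZero)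
open import Data.Nat.DivMod using (_%_)
open import Data.Fin using (Fin; toℕ)
open import Data.Product using (_×_; Σ; ∃; _,_)
open import Function.Bundles using (_⤖_; Bijection; _⇔_)
open import Relation.Binary.PropositionalEquality using (_≡_)
open import Relation.Nullary using (¬_)

Graph : Set → Set₁
Graph V = V → V → Set

K : (m : ℕ) → Graph (Fin m)
K m i j = ¬ (i ≡ j)

_⊗_ : {V W : Set} → Graph V → Graph W → Graph (V × W)
(G ⊗ H) (g , h) (g' , h') = G g g' × H h h'

_-ₙ_ : {N : ℕ} .{{_ : NonZero N}} → Fin N → Fin N → ℕ
_-ₙ_ {N} j i = (toℕ j + (N ∸ toℕ i)) % N

negₙ : {N : ℕ} .{{_ : NonZero N}} → Fin N → ℕ
negₙ {N} s = (N ∸ toℕ s) % N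

SymmetricSet : (N : ℕ) .{{_ : NonZero N}} → (Fin N → Set) → Set
SymmetricSet N S = ∀ s t → toℕ t ≡ negₙ s → S s → S t

IsCirculant : {V : Set} (N : ℕ) .{{_ : NonZero N}} → Graph V → Set₁
IsCirculant {V} N G =
  Σ (Fin N ⤖ V) λ σ →
  Σ (Fin N → Set) λ S →
    SymmetricSet N S ×
    (∀ i j → G (Bijection.to σ i) (Bijection.to σ j) ⇔ (∃ λ d → toℕ d ≡ (j -ₙ i) × S d))

module Submission where

-- Translation by 1 in ℤ_N is an automorphism of a circulant graph, and the orbit of a vertex
-- under it visits all N vertices before returning. An automorphism of K_m ⊗ K_n is one of the
-- complementary rook's graph, i.e. a permutation of the m × n grid preserving collinearity, and
-- for m, n ≥ 2 it either preserves both families of lines or interchanges them. In the first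
-- case the row and column coordinates along the orbit are periodic with exact periods m and n
-- (exact because every row and column is visited), so the orbit returns after lcm(m,n) < mn
-- steps. In the second case m = n and the square of the translation preserves lines, so the
-- orbit returns after 2n < n² steps unless n = 2.

open import Defs
open import Data.Nat using (ℕ; zero; suc; _+_; _*_; _∸_; _≤_; _<_; z≤n; s≤s; s≤s⁻¹; NonZero; >-nonZero; >-nonZero⁻¹; ≢-nonZero⁻¹)
open import Data.Nat.Properties
open import Data.Nat.DivMod using (_%_; _/_; m≡m%n+[m/n]*n; m%n<n; m<n⇒m%n≡m; %-distribˡ-+; m%n%n≡m%n; [m+n]%n≡m%n; n%n≡0)
open import Data.Nat.Divisibility using (_∣_; divides; ∣-refl; ∣-reflexive)
open import Data.Nat.GCD using (gcd; gcd-zeroˡ; gcd-zeroʳ)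
open import Data.Nat.LCM using (lcm; m∣lcm[m,n]; n∣lcm[m,n]; gcd*lcm)
open import Data.Fin using (Fin; toℕ; fromℕ<; punchIn) renaming (zero to fzero)
open import Data.Fin.Properties using (pigeonhole; injective⇒≤; toℕ-fromℕ<; toℕ<n; toℕ-injective; punchInᵢ≢i) renaming (_≟_ to _≟ᶠ_)
open import Data.Product using (∃; ∃-syntax; _×_; _,_; proj₁; proj₂)
open import Data.Sum using (_⊎_; inj₁; inj₂)
open import Data.Empty using (⊥; ⊥-elim)
open import Function using (_∘_; Injective; _⇔_; Equivalence; Inverse; Bijection)
open import Function.Properties.Bijection using (⤖⇒↔)
import Function.Properties.Equivalence as ⇔
open import Relation.Nullary using (¬_; yes; no)
open import Relation.Binary.PropositionalEquality

surjective⇒≥ : ∀ {m n} {f : Fin m → Fin n} → (∀ i → ∃ λ j → f j ≡ i) → n ≤ m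
surjective⇒≥ {f = f} surj = injective⇒≤ {f = proj₁ ∘ surj} λ {i} {j} eq →
  trans (sym (proj₂ (surj i))) (trans (cong f eq) (proj₂ (surj j)))

Periodic : {A : Set} → ℕ → (ℕ → A) → Set
Periodic p u = ∀ k → u (p + k) ≡ u k

module _ {A : Set} {p : ℕ} {u : ℕ → A} (per : Periodic p u) where

  periodic-*+ : ∀ q r → u (q * p + r) ≡ u r
  periodic-*+ zero    r = refl
  periodic-*+ (suc q) r = trans (cong u (+-assoc p (q * p) r)) (trans (per (q * p + r)) (periodic-*+ q r))

  periodic-∣ : ∀ {g} → p ∣ g → u g ≡ u 0
  periodic-∣ (divides q refl) = trans (cong u (sym (+-identityʳ (q * p)))) (periodic-*+ q 0)

  periodic-% : .{{_ : NonZero p}} → ∀ k → u (k % p) ≡ u k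
  periodic-% k = begin
    u (k % p)               ≡⟨ sym (periodic-*+ (k / p) (k % p)) ⟩
    u (k / p * p + k % p)   ≡⟨ cong u (+-comm (k / p * p) (k % p)) ⟩
    u (k % p + k / p * p)   ≡⟨ cong u (sym (m≡m%n+[m/n]*n k p)) ⟩
    u k                     ∎
    where open ≡-Reasoning

module ShiftCompatible {m : ℕ} (u : ℕ → Fin m)
  (step   : ∀ {x y} → u x ≡ u y → u (suc x) ≡ u (suc y))
  (unstep : ∀ {x y} → u (suc x) ≡ u (suc y) → u x ≡ u y) where

  shift : ∀ k {x y} → u x ≡ u y → u (k + x) ≡ u (k + y)
  shift zero    eq = eq
  shift (suc k) eq = step (shift k eq)

  unshift : ∀ k {x y} → u (k + x) ≡ u (k + y) → u x ≡ u y
  unshift zero    eq = eq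
  unshift (suc k) eq = unshift k (unstep eq)

  short-period : ∃ λ p → 0 < p × p ≤ m × Periodic p u
  short-period with pigeonhole (n<1+n m) (u ∘ toℕ)
  ... | i , j , i<j , eq = p , m<n⇒0<n∸m i<j , ≤-trans (m∸n≤m (toℕ j) (toℕ i)) (s≤s⁻¹ (toℕ<n j)) , period
    where
    p = toℕ j ∸ toℕ i
    recurs : u 0 ≡ u p
    recurs = unshift (toℕ i)
      (subst₂ (λ x y → u x ≡ u y) (sym (+-identityʳ (toℕ i))) (sym (m+[n∸m]≡n (<⇒≤ i<j))) eq)
    period : Periodic p u
    period k = subst₂ (λ x y → u x ≡ u y) (+-comm k p) (+-identityʳ k) (shift k (sym recurs))

  -- A period p ≤ m exists by pigeonhole; surjectivity forces p ≥ m.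
  surjective⇒periodic : (∀ i → ∃ λ k → u k ≡ i) → Periodic m u
  surjective⇒periodic surj with short-period
  ... | p , 0<p , p≤m , per = subst (λ q → Periodic q u) (≤-antisym p≤m m≤p) per
    where
    instance _ = >-nonZero 0<p
    m≤p : m ≤ p
    m≤p = surjective⇒≥ {f = u ∘ toℕ} λ i →
      let k , uk≡i = surj i in
      fromℕ< (m%n<n k p) , trans (cong u (toℕ-fromℕ< (m%n<n k p))) (trans (periodic-% per k) uk≡i)

parity : ∀ t → ∃ λ k → t ≡ k + k ⊎ t ≡ suc (k + k)
parity zero = zero , inj₁ refl
parity (suc t) with parity t
... | k , inj₁ refl = k , inj₂ refl
... | k , inj₂ refl = suc k , inj₁ (cong suc (sym (+-suc k k)))

another : ∀ {k} → Fin (suc (suc k)) → Fin (suc (suc k))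
another i = punchIn i fzero

another-≢ : ∀ {k} (i : Fin (suc (suc k))) → another i ≢ i
another-≢ i = punchInᵢ≢i i fzero

data Axis : Set where
  row col : Axis

perp : Axis → Axis
perp row = col
perp col = row

perp-involutive : ∀ a → perp (perp a) ≡ a
perp-involutive row = refl
perp-involutive col = refl

axis-dichotomy : ∀ s t → s ≡ t ⊎ s ≡ perp t
axis-dichotomy row row = inj₁ refl
axis-dichotomy row col = inj₂ refl
axis-dichotomy col row = inj₂ refl
axis-dichotomy col col = inj₁ refl

-- A collineation of the grid permutes the two axes; rowTo t is the permutation taking row to t.
rowTo : Axis → Axis → Axis
rowTo t row = t
rowTo t col = perp t

rowTo-row : ∀ a → rowTo row a ≡ a
rowTo-row row = refl
rowTo-row col = refl

rowTo-perpʳ : ∀ t a → rowTo t (perp a) ≡ perp (rowTo t a)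
rowTo-perpʳ t row = refl
rowTo-perpʳ t col = sym (perp-involutive t)

rowTo-perpˡ : ∀ t a → rowTo (perp t) a ≡ perp (rowTo t a)
rowTo-perpˡ t row = refl
rowTo-perpˡ t col = refl

rowTo-col-perp : ∀ a → rowTo col (perp a) ≡ a
rowTo-col-perp row = refl
rowTo-col-perp col = refl

-- The (m+2) × (n+2) grid: with a side of length 1 the rook's graph is complete and the
-- dichotomy for its automorphisms fails.
module Grid (m n : ℕ) where

  extent : Axis → ℕ
  extent row = suc (suc m)
  extent col = suc (suc n)

  Point : Set
  Point = Fin (extent row) × Fin (extent col)

  coord : ∀ a → Point → Fin (extent a)
  coord row = proj₁
  coord col = proj₂

  SameLine : Axis → Point → Point → Set
  SameLine a x y = coord a x ≡ coord a y

  Collinear : Point → Point → Set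
  Collinear x y = ∃[ a ] SameLine a x y

  origin : Point
  origin = fzero , fzero

  meet : ∀ a → Fin (extent a) → Point → Point
  meet row i x = i , proj₂ x
  meet col i x = proj₁ x , i

  coord-meet : ∀ a i x → coord a (meet a i x) ≡ i
  coord-meet row i x = refl
  coord-meet col i x = refl

  meet-perp : ∀ a i x → SameLine (perp a) (meet a i x) x
  meet-perp row i x = refl
  meet-perp col i x = refl

  partner : Axis → Point → Point
  partner row x = proj₁ x , another (proj₂ x)
  partner col x = another (proj₁ x) , proj₂ x

  partner-same : ∀ a x → SameLine a x (partner a x)
  partner-same row x = refl
  partner-same col x = refl

  partner-apart : ∀ a x → ¬ SameLine (perp a) x (partner a x)
  partner-apart row x = another-≢ (proj₂ x) ∘ sym
  partner-apart col x = another-≢ (proj₁ x) ∘ sym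

  sameLine-both : ∀ a {x y} → SameLine a x y → SameLine (perp a) x y → x ≡ y
  sameLine-both row eq₁ eq₂ = cong₂ _,_ eq₁ eq₂
  sameLine-both col eq₁ eq₂ = cong₂ _,_ eq₂ eq₁

  collinear-perp : ∀ a {x y} → Collinear x y → ¬ SameLine a x y → SameLine (perp a) x y
  collinear-perp row (row , eq) ¬eq = ⊥-elim (¬eq eq)
  collinear-perp row (col , eq) ¬eq = eq
  collinear-perp col (row , eq) ¬eq = eq
  collinear-perp col (col , eq) ¬eq = ⊥-elim (¬eq eq)

  collinear-perp⁻ : ∀ a {x y} → Collinear x y → ¬ SameLine (perp a) x y → SameLine a x y
  collinear-perp⁻ a {x} {y} c ¬eq =
    subst (λ b → SameLine b x y) (perp-involutive a) (collinear-perp (perp a) c ¬eq)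

  surjective⇒meets-lines : (p : ℕ → Point) → (∀ x → ∃ λ k → p k ≡ x) →
                           ∀ a i → ∃ λ k → coord a (p k) ≡ i
  surjective⇒meets-lines p surj a i =
    let k , pk≡x = surj (meet a i origin) in
    k , trans (cong (coord a) pk≡x) (coord-meet a i origin)

  periodic⇒returns : ∀ (p : ℕ → Point) {g} →
            Periodic (extent row) (coord row ∘ p) → Periodic (extent col) (coord col ∘ p) →
            extent row ∣ g → extent col ∣ g → p g ≡ p 0
  periodic⇒returns p perRow perCol ∣₁ ∣₂ = cong₂ _,_ (periodic-∣ perRow ∣₁) (periodic-∣ perCol ∣₂)

  -- K m ⊗ K n is the complement of the rook's graph, whose edges join collinear points.
  Adjacent : Point → Point → Set
  Adjacent = K (extent row) ⊗ K (extent col)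

  collinear⇒¬adjacent : ∀ {x y} → Collinear x y → ¬ Adjacent x y
  collinear⇒¬adjacent (row , eq) (≢₁ , _) = ≢₁ eq
  collinear⇒¬adjacent (col , eq) (_ , ≢₂) = ≢₂ eq

  ¬adjacent⇒collinear : ∀ x y → ¬ Adjacent x y → Collinear x y
  ¬adjacent⇒collinear x y ¬adj with proj₁ x ≟ᶠ proj₁ y | proj₂ x ≟ᶠ proj₂ y
  ... | yes eq | _      = row , eq
  ... | no  _  | yes eq = col , eq
  ... | no ≢₁  | no ≢₂  = ⊥-elim (¬adj (≢₁ , ≢₂))

  record IsCollineation (f : Point → Point) : Set where
    field
      injective  : Injective _≡_ _≡_ f
      collinear  : ∀ {x y} → Collinear x y → Collinear (f x) (f y)
      collinear⁻ : ∀ {x y} → Collinear (f x) (f y) → Collinear x y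

  automorphism⇒isCollineation : ∀ {f} → Injective _≡_ _≡_ f →
    (∀ x y → Adjacent x y ⇔ Adjacent (f x) (f y)) → IsCollineation f
  automorphism⇒isCollineation {f} inj adj = record
    { injective  = inj
    ; collinear  = λ {x} {y} c → ¬adjacent⇒collinear (f x) (f y) (collinear⇒¬adjacent c ∘ Equivalence.from (adj x y))
    ; collinear⁻ = λ {x} {y} c → ¬adjacent⇒collinear x y (collinear⇒¬adjacent c ∘ Equivalence.to (adj x y))
    }

  ∘-isCollineation : ∀ {f g} → IsCollineation f → IsCollineation g → IsCollineation (g ∘ f)
  ∘-isCollineation F G = record
    { injective  = F.injective ∘ G.injective
    ; collinear  = G.collinear ∘ F.collinear
    ; collinear⁻ = F.collinear⁻ ∘ G.collinear⁻
    }
    where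
    module F = IsCollineation F
    module G = IsCollineation G

  Sends : (Point → Point) → Axis → Axis → Point → Set
  Sends f a b x = ∀ y → SameLine a x y → SameLine b (f x) (f y)

  Acts : (Point → Point) → Axis → Point → Set
  Acts f t x = ∀ a → Sends f a (rowTo t a) x

  acts-col∘acts-col : ∀ {f} → (∀ y → Acts f col y) → ∀ y → Acts (f ∘ f) row y
  acts-col∘acts-col {f} act y row z eq = act (f y) col (f z) (act y row z eq)
  acts-col∘acts-col {f} act y col z eq = act (f y) row (f z) (act y col z eq)

  module Collineation {f : Point → Point} (isCollineation : IsCollineation f) where
    open IsCollineation isCollineation

    -- How f treats the lines through x is decided by any second point w on one of them.
    module _ {a b x w} (xw : SameLine a x w) (¬xw : ¬ SameLine (perp a) x w)
                       (fxw : SameLine b (f x) (f w)) where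

      sends-along : Sends f a b x
      sends-along y xy with coord b (f x) ≟ᶠ coord b (f y)
      ... | yes eq = eq
      ... | no ¬eq = ⊥-elim (¬xw (cong (coord (perp a)) (injective (sameLine-both b fxw perp-xw))))
        where
        perp-xy = collinear-perp b (collinear (a , xy)) ¬eq
        perp-wy = collinear-perp b (collinear (a , trans (sym xw) xy)) (λ wy → ¬eq (trans fxw wy))
        perp-xw = trans perp-xy (sym perp-wy)

      sends-across : Sends f (perp a) (perp b) x
      sends-across y xy with coord (perp b) (f x) ≟ᶠ coord (perp b) (f y)
      ... | yes eq = eq
      ... | no ¬eq with coord a y ≟ᶠ coord a w
      ...   | yes yw = ⊥-elim (¬eq (cong (coord (perp b) ∘ f) (sameLine-both a (trans xw (sym yw)) xy)))
      ...   | no ¬yw = ⊥-elim (¬xw (trans xy (collinear-perp a (collinear⁻ (b , fyw)) ¬yw)))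
        where fyw = trans (sym (collinear-perp⁻ b (collinear (perp a , xy)) ¬eq)) fxw

    acts-at : ∀ x → ∃[ t ] Acts f t x
    acts-at x with collinear {x} {partner row x} (row , partner-same row x)
    ... | t , fxw = t , λ where
      row → sends-along  {a = row} (partner-same row x) (partner-apart row x) fxw
      col → sends-across {a = row} (partner-same row x) (partner-apart row x) fxw

    acts-exclusive : ∀ {t a x y} → Acts f t x → Acts f (perp t) y → SameLine a x y → ⊥
    acts-exclusive {t} {a} {x} {y} actˣ actʸ xy =
      partner-apart a x (cong (coord (perp a)) (injective (sameLine-both (rowTo t a) fxw fxw′)))
      where
      w = partner a x
      xw = partner-same a x
      fxw = actˣ a w xw
      fxw′ = subst (λ b → SameLine b (f x) (f w)) (rowTo-perpˡ t a)
               (trans (sym (actʸ a x (sym xy))) (actʸ a w (trans (sym xy) xw)))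

    acts-spread : ∀ {t a x y} → Acts f t x → SameLine a x y → Acts f t y
    acts-spread {t} {y = y} actˣ xy with acts-at y
    ... | s , actʸ with axis-dichotomy s t
    ...   | inj₁ refl = actʸ
    ...   | inj₂ refl = ⊥-elim (acts-exclusive actˣ actʸ xy)

    -- Any two points are joined through the corner sharing a row with one and a column with the other.
    acts-everywhere : ∀ {t x} → Acts f t x → ∀ y → Acts f t y
    acts-everywhere {x = x} actˣ y = acts-spread {a = col} (acts-spread {a = row} actˣ refl) (meet-perp row (proj₁ x) y)

    dichotomy : ∃[ t ] (∀ y → Acts f t y)
    dichotomy = let t , act = acts-at origin in t , acts-everywhere act

    reflects : ∀ {t} → (∀ y → Acts f t y) → ∀ a {x y} → SameLine (rowTo t a) (f x) (f y) → SameLine a x y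
    reflects {t} act a {x} {y} fxy with coord a x ≟ᶠ coord a y
    ... | yes xy = xy
    ... | no ¬xy = ⊥-elim (¬xy (cong (coord a) (injective (sameLine-both (rowTo t a) fxy perp-fxy))))
      where
      perp-fxy = subst (λ b → SameLine b (f x) (f y)) (rowTo-perpʳ t a)
                   (act x (perp a) y (collinear-perp a (collinear⁻ (rowTo t a , fxy)) ¬xy))

    extent-≤ : ∀ {t} → (∀ y → Acts f t y) → ∀ a → extent a ≤ extent (rowTo t a)
    extent-≤ act a = injective⇒≤ {f = λ i → coord (rowTo _ a) (f (meet a i origin))} λ {i} {j} eq →
      trans (sym (coord-meet a i origin)) (trans (reflects act a eq) (coord-meet a j origin))

    acts-col⇒square : (∀ y → Acts f col y) → extent row ≡ extent col
    acts-col⇒square act = ≤-antisym (extent-≤ act row) (extent-≤ act col)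

    module _ (p : ℕ → Point) (orbit-suc : ∀ k → f (p k) ≡ p (suc k)) where

      acts-row⇒periodic : (∀ y → Acts f row y) → ∀ a → (∀ i → ∃ λ k → coord a (p k) ≡ i) →
                          Periodic (extent a) (coord a ∘ p)
      acts-row⇒periodic act a = ShiftCompatible.surjective⇒periodic (coord a ∘ p) step unstep
        where
        preserves : ∀ a {x y} → SameLine a x y → SameLine a (f x) (f y)
        preserves row = act _ row _
        preserves col = act _ col _
        step : ∀ {x y} → coord a (p x) ≡ coord a (p y) → coord a (p (suc x)) ≡ coord a (p (suc y))
        step {x} {y} eq = subst₂ (SameLine a) (orbit-suc x) (orbit-suc y) (preserves a eq)
        unstep : ∀ {x y} → coord a (p (suc x)) ≡ coord a (p (suc y)) → coord a (p x) ≡ coord a (p y)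
        unstep {x} {y} eq = reflects act a
          (subst (λ b → SameLine b (f (p x)) (f (p y))) (sym (rowTo-row a))
            (subst₂ (SameLine a) (sym (orbit-suc x)) (sym (orbit-suc y)) eq))

      even-or-odd : (∀ x → ∃ λ k → p k ≡ x) → ∀ x → ∃ λ k → p (k + k) ≡ x ⊎ f (p (k + k)) ≡ x
      even-or-odd surj x with surj x
      ... | t , pt≡x with parity t
      ...   | k , inj₁ refl = k , inj₁ pt≡x
      ...   | k , inj₂ refl = k , inj₂ (trans (orbit-suc (k + k)) pt≡x)

      acts-col⇒even-meets-lines : (∀ y → Acts f col y) → (∀ x → ∃ λ k → p k ≡ x) →
                                  ∀ a i → ∃ λ k → coord a (p (k + k)) ≡ i
      acts-col⇒even-meets-lines act surj a i with even-or-odd surj (meet a i origin)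
      ... | k , inj₁ eq = k , trans (cong (coord a) eq) (coord-meet a i origin)
      ... | k , inj₂ eq = via (p (k + k)) (trans (cong (coord a) eq) (coord-meet a i origin))
        where
        -- f maps the perpendicular line through v onto the a-line through f v.
        via : ∀ v → coord a (f v) ≡ i → ∃ λ k → coord a (p (k + k)) ≡ i
        via v fv∈i with even-or-odd surj (meet a i v)
        ... | k , inj₁ eq = k , trans (cong (coord a) eq) (coord-meet a i v)
        ... | k , inj₂ eq = suc k , (begin
          coord a (p (suc k + suc k))      ≡⟨ cong (coord a ∘ p ∘ suc) (+-suc k k) ⟩
          coord a (p (suc (suc (k + k))))  ≡⟨ cong (coord a) (sym (trans (cong f (orbit-suc (k + k))) (orbit-suc (suc (k + k))))) ⟩
          coord a (f (f (p (k + k))))      ≡⟨ cong (coord a ∘ f) eq ⟩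
          coord a (f (meet a i v))         ≡⟨ subst (λ b → SameLine b (f (meet a i v)) (f v)) (rowTo-col-perp a)
                                                (act _ (perp a) v (meet-perp a i v)) ⟩
          coord a (f v)                    ≡⟨ fv∈i ⟩
          i                                ∎)
          where open ≡-Reasoning

module Residues (N : ℕ) .{{_ : NonZero N}} where

  %-absorbʳ : ∀ x y → (x + y % N) % N ≡ (x + y) % N
  %-absorbʳ x y = begin
    (x + y % N) % N             ≡⟨ %-distribˡ-+ x (y % N) N ⟩
    (x % N + y % N % N) % N     ≡⟨ cong (λ z → (x % N + z) % N) (m%n%n≡m%n y N) ⟩
    (x % N + y % N) % N         ≡⟨ sym (%-distribˡ-+ x y N) ⟩
    (x + y) % N                 ∎
    where open ≡-Reasoning

  %-absorbˡ : ∀ x y → (x % N + y) % N ≡ (x + y) % N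
  %-absorbˡ x y = begin
    (x % N + y) % N   ≡⟨ cong (_% N) (+-comm (x % N) y) ⟩
    (y + x % N) % N   ≡⟨ %-absorbʳ y x ⟩
    (y + x) % N       ≡⟨ cong (_% N) (+-comm y x) ⟩
    (x + y) % N       ∎
    where open ≡-Reasoning

  -- Truncated subtraction: N ∸ y is the additive inverse of y modulo N only for y ≤ N.
  %-∸ : ∀ x {y} → y ≤ N → (x % N + (N ∸ y % N)) % N ≡ (x + (N ∸ y)) % N
  %-∸ x {y} y≤N with m≤n⇒m<n∨m≡n y≤N
  ... | inj₁ y<N = trans (cong (λ z → (x % N + (N ∸ z)) % N) (m<n⇒m%n≡m y<N)) (%-absorbˡ x (N ∸ y))
  ... | inj₂ refl = begin
    (x % N + (N ∸ N % N)) % N   ≡⟨ cong (λ z → (x % N + (N ∸ z)) % N) (n%n≡0 N) ⟩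
    (x % N + N) % N             ≡⟨ [m+n]%n≡m%n (x % N) N ⟩
    x % N % N                   ≡⟨ m%n%n≡m%n x N ⟩
    x % N                       ≡⟨ cong (_% N) (sym (+-identityʳ x)) ⟩
    (x + 0) % N                 ≡⟨ cong (λ z → (x + z) % N) (sym (n∸n≡0 N)) ⟩
    (x + (N ∸ N)) % N           ∎
    where open ≡-Reasoning

  residue : ℕ → Fin N
  residue k = fromℕ< (m%n<n k N)

  toℕ-residue : ∀ k → toℕ (residue k) ≡ k % N
  toℕ-residue k = toℕ-fromℕ< (m%n<n k N)

  residue-toℕ : ∀ i → residue (toℕ i) ≡ i
  residue-toℕ i = toℕ-injective (trans (toℕ-residue (toℕ i)) (m<n⇒m%n≡m (toℕ<n i)))

  residue-injective-below : ∀ {g} → g < N → residue g ≡ residue 0 → g ≡ 0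
  residue-injective-below {g} g<N eq = begin
    g                   ≡⟨ sym (m<n⇒m%n≡m g<N) ⟩
    g % N               ≡⟨ sym (toℕ-residue g) ⟩
    toℕ (residue g)     ≡⟨ cong toℕ eq ⟩
    toℕ (residue 0)     ≡⟨ toℕ-residue 0 ⟩
    0 % N               ≡⟨ m<n⇒m%n≡m (>-nonZero⁻¹ N) ⟩
    0                   ∎
    where open ≡-Reasoning

  rotate : Fin N → Fin N
  rotate i = residue (suc (toℕ i))

  toℕ-rotate : ∀ i → toℕ (rotate i) ≡ suc (toℕ i) % N
  toℕ-rotate i = toℕ-residue (suc (toℕ i))

  residue-suc : ∀ k → rotate (residue k) ≡ residue (suc k)
  residue-suc k = toℕ-injective (begin
    toℕ (rotate (residue k))   ≡⟨ toℕ-rotate (residue k) ⟩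
    suc (toℕ (residue k)) % N  ≡⟨ cong (λ z → suc z % N) (toℕ-residue k) ⟩
    (1 + k % N) % N            ≡⟨ %-absorbʳ 1 k ⟩
    suc k % N                  ≡⟨ sym (toℕ-residue (suc k)) ⟩
    toℕ (residue (suc k))      ∎)
    where open ≡-Reasoning

  -- Adding N ∸ 1 undoes the rotation.
  rotate-injective : Injective _≡_ _≡_ rotate
  rotate-injective {i} {j} eq = toℕ-injective (trans (unrotate i) (trans (cong (λ k → (toℕ k + (N ∸ 1)) % N) eq) (sym (unrotate j))))
    where
    unrotate : ∀ i → toℕ i ≡ (toℕ (rotate i) + (N ∸ 1)) % N
    unrotate i = sym (begin
      (toℕ (rotate i) + (N ∸ 1)) % N  ≡⟨ cong (λ z → (z + (N ∸ 1)) % N) (toℕ-rotate i) ⟩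
      (suc (toℕ i) % N + (N ∸ 1)) % N ≡⟨ %-absorbˡ (suc (toℕ i)) (N ∸ 1) ⟩
      (suc (toℕ i) + (N ∸ 1)) % N     ≡⟨ cong (_% N) (sym (+-suc (toℕ i) (N ∸ 1))) ⟩
      (toℕ i + suc (N ∸ 1)) % N       ≡⟨ cong (λ z → (toℕ i + z) % N) (m+[n∸m]≡n (>-nonZero⁻¹ N)) ⟩
      (toℕ i + N) % N                 ≡⟨ [m+n]%n≡m%n (toℕ i) N ⟩
      toℕ i % N                       ≡⟨ m<n⇒m%n≡m (toℕ<n i) ⟩
      toℕ i                           ∎)
      where open ≡-Reasoning

  rotate-difference : ∀ i j → (rotate j -ₙ rotate i) ≡ (j -ₙ i)
  rotate-difference i j = begin
    (toℕ (rotate j) + (N ∸ toℕ (rotate i))) % N          ≡⟨ cong₂ (λ x y → (x + (N ∸ y)) % N) (toℕ-rotate j) (toℕ-rotate i) ⟩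
    (suc (toℕ j) % N + (N ∸ suc (toℕ i) % N)) % N        ≡⟨ %-∸ (suc (toℕ j)) (toℕ<n i) ⟩
    (suc (toℕ j) + (N ∸ suc (toℕ i))) % N                ≡⟨ cong (_% N) (sym (+-suc (toℕ j) (N ∸ suc (toℕ i)))) ⟩
    (toℕ j + suc (N ∸ suc (toℕ i))) % N                  ≡⟨ cong (λ z → (toℕ j + z) % N) (sym (+-∸-assoc 1 (toℕ<n i))) ⟩
    (toℕ j + (N ∸ toℕ i)) % N                            ∎
    where open ≡-Reasoning

record CyclicAutomorphism {V : Set} (N : ℕ) (G : Graph V) : Set where
  field
    rotate           : V → V
    rotate-injective : Injective _≡_ _≡_ rotate
    rotate-adjacent  : ∀ u v → G u v ⇔ G (rotate u) (rotate v)
    orbit            : ℕ → V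
    orbit-suc        : ∀ k → rotate (orbit k) ≡ orbit (suc k)
    orbit-surjective : ∀ v → ∃ λ k → orbit k ≡ v
    orbit-aperiodic  : ∀ {g} → 0 < g → g < N → orbit g ≢ orbit 0

circulant⇒cyclicAutomorphism : ∀ {V} {G : Graph V} {N} .{{_ : NonZero N}} →
                               IsCirculant N G → CyclicAutomorphism N G
circulant⇒cyclicAutomorphism {G = G} {N} (σ , S , _ , adjacent⇔) = record
  { rotate           = to ∘ R.rotate ∘ from
  ; rotate-injective = from-injective ∘ R.rotate-injective ∘ Bijection.injective σ
  ; rotate-adjacent  = λ u v → subst₂ (λ x y → G x y ⇔ G (to (R.rotate (from u))) (to (R.rotate (from v))))
                                 (strictlyInverseˡ u) (strictlyInverseˡ v) (rotate-adjacent′ (from u) (from v))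
  ; orbit            = to ∘ R.residue
  ; orbit-suc        = λ k → trans (cong (to ∘ R.rotate) (strictlyInverseʳ (R.residue k))) (cong to (R.residue-suc k))
  ; orbit-surjective = λ v → toℕ (from v) , trans (cong to (R.residue-toℕ (from v))) (strictlyInverseˡ v)
  ; orbit-aperiodic  = λ 0<g g<N eq → <-irrefl (sym (R.residue-injective-below g<N (Bijection.injective σ eq))) 0<g
  }
  where
  module R = Residues N
  open Inverse (⤖⇒↔ σ) using (to; from; strictlyInverseˡ; strictlyInverseʳ)
  from-injective : Injective _≡_ _≡_ from
  from-injective {u} {v} eq = trans (sym (strictlyInverseˡ u)) (trans (cong to eq) (strictlyInverseˡ v))
  rotate-adjacent′ : ∀ i j → G (to i) (to j) ⇔ G (to (R.rotate i)) (to (R.rotate j))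
  rotate-adjacent′ i j = ⇔.trans (adjacent⇔ i j)
    (⇔.sym (subst (λ d → G (to (R.rotate i)) (to (R.rotate j)) ⇔ ∃ λ s → toℕ s ≡ d × S s)
             (R.rotate-difference i j) (adjacent⇔ (R.rotate i) (R.rotate j))))

lcm-between : ∀ m n .{{_ : NonZero m}} .{{_ : NonZero n}} → 1 < gcd m n → 0 < lcm m n × lcm m n < m * n
lcm-between m n 1<gcd = 0<lcm , (begin-strict
  lcm m n             <⟨ m<m*n (lcm m n) (gcd m n) {{>-nonZero 0<lcm}} 1<gcd ⟩
  lcm m n * gcd m n   ≡⟨ *-comm (lcm m n) (gcd m n) ⟩
  gcd m n * lcm m n   ≡⟨ gcd*lcm m n ⟩
  m * n               ∎)
  where
  open ≤-Reasoning
  0<lcm : 0 < lcm m n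
  0<lcm = n≢0⇒n>0 λ lcm≡0 → ≢-nonZero⁻¹ (m * n) {{m*n≢0 m n}}
    (trans (sym (gcd*lcm m n)) (trans (cong (gcd m n *_) lcm≡0) (*-zeroʳ (gcd m n))))

double<square : ∀ {k} → 2 < k → k + k < k * k
double<square {k} 2<k = subst (_< k * k) (cong (k +_) (+-identityʳ k)) (*-monoˡ-< k {{>-nonZero (<-trans (s≤s z≤n) 2<k)}} 2<k)

module RookComplement (m n : ℕ) where
  open Grid m n

  module _ (cyclic : CyclicAutomorphism (extent row * extent col) Adjacent) where
    open CyclicAutomorphism cyclic

    isCollineation : IsCollineation rotate
    isCollineation = automorphism⇒isCollineation rotate-injective rotate-adjacent

    open Collineation isCollineation

    ¬acts-row : 1 < gcd (extent row) (extent col) → ¬ (∀ y → Acts rotate row y)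
    ¬acts-row 1<gcd act with lcm-between (extent row) (extent col) 1<gcd
    ... | 0<lcm , lcm<N = orbit-aperiodic 0<lcm lcm<N
      (periodic⇒returns orbit (periodic row) (periodic col)
        (m∣lcm[m,n] (extent row) (extent col)) (n∣lcm[m,n] (extent row) (extent col)))
      where
      periodic : ∀ a → Periodic (extent a) (coord a ∘ orbit)
      periodic a = acts-row⇒periodic orbit orbit-suc act a (surjective⇒meets-lines orbit orbit-surjective a)

    ¬acts-col : ¬ (extent row ≡ 2 × extent col ≡ 2) → ¬ (∀ y → Acts rotate col y)
    ¬acts-col ¬2,2 act = orbit-aperiodic (s≤s z≤n) 2n<N
      (periodic⇒returns evenOrbit (periodic row) (periodic col) (∣-reflexive square) ∣-refl)
      where
      square : extent row ≡ extent col
      square = acts-col⇒square act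
      2<n : 2 < extent col
      2<n = ≤∧≢⇒< (s≤s (s≤s z≤n)) λ 2≡n → ¬2,2 (trans square (sym 2≡n) , sym 2≡n)
      2n<N : extent col + extent col < extent row * extent col
      2n<N = subst (λ k → extent col + extent col < k * extent col) (sym square) (double<square 2<n)
      evenOrbit : ℕ → Point
      evenOrbit k = orbit (k + k)
      evenOrbit-suc : ∀ k → rotate (rotate (evenOrbit k)) ≡ evenOrbit (suc k)
      evenOrbit-suc k = trans (cong rotate (orbit-suc (k + k)))
                              (trans (orbit-suc (suc (k + k))) (cong (orbit ∘ suc) (sym (+-suc k k))))
      periodic : ∀ a → Periodic (extent a) (coord a ∘ evenOrbit)
      periodic a = Collineation.acts-row⇒periodic
        (∘-isCollineation isCollineation isCollineation)
        evenOrbit evenOrbit-suc (acts-col∘acts-col act) a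
        (acts-col⇒even-meets-lines orbit orbit-suc act orbit-surjective a)

    ¬cyclicAutomorphism : 1 < gcd (extent row) (extent col) → ¬ (extent row ≡ 2 × extent col ≡ 2) → ⊥
    ¬cyclicAutomorphism 1<gcd ¬2,2 with dichotomy
    ... | row , act = ¬acts-row 1<gcd act
    ... | col , act = ¬acts-col ¬2,2 act

theorem2 : (m n : ℕ) .{{_ : NonZero m}} .{{_ : NonZero n}} →
    1 < gcd m n →
    ¬ (m ≡ 2 × n ≡ 2) →
    ¬ IsCirculant (m * n) {{m*n≢0 m n}} (K m ⊗ K n)
theorem2 zero            n          _     _ _ = ≢-nonZero⁻¹ 0 refl
theorem2 (suc (suc _))   zero       _     _ _ = ≢-nonZero⁻¹ 0 refl
theorem2 (suc zero)      n          1<gcd _ _ = <-irrefl (sym (gcd-zeroˡ n)) 1<gcd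
theorem2 m@(suc (suc _)) (suc zero) 1<gcd _ _ = <-irrefl (sym (gcd-zeroʳ m)) 1<gcd
theorem2 (suc (suc m)) (suc (suc n)) 1<gcd ¬2,2 circulant =
  RookComplement.¬cyclicAutomorphism m n (circulant⇒cyclicAutomorphism circulant) 1<gcd ¬2,2
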